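{- Let $b\geq 2$ and $k\geq 1$ be integers. If there exists a $k$-oasis base $b$, then there exist infinitely many $k$-oases base $b$.
   Context: For integers $c\geq 0$ and $b\geq 2$, the augmented generalized happy function $S_{[c,b]}:\mathbb{Z}^+\to\mathbb{Z}^+$ is defined by $S_{[c,b]}\left(\sum_{i=0}^n a_i b^i\right)=c+\sum_{i=0}^n a_i^2$, where $0\le a_i\le b-1$, $a_n\neq 0$ (the base $b$ expansion). A positive integer $a$ is a fixed point of $S_{[c,b]}$ if $S_{[c,b]}(a)=a$. For $b\geq 2$ and $k\in\mathbb{Z}^+$, a $k$-oasis base $b$ is a set of $k$ consecutive non-negative integers $c$ such that for each of them $S_{[c,b]}$ has at least one fixed point. -}

module Defs where

open import Data.Nat using (ℕ; zero; suc; _+_; _*_; _≤_; _<_; NonZero)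
open import Data.Nat.DivMod using (_/_; _%_)
open import Data.Product using (Σ; _×_)
open import Relation.Binary.PropositionalEquality using (_≡_)

-- Sum of squares of the base-b digits of n, computed with fuel
-- (fuel ≥ n suffices since every division step strictly decreases n for b ≥ 2).
digitSqSumFuel : ℕ → (b : ℕ) → .{{NonZero b}} → ℕ → ℕ
digitSqSumFuel zero    b n = 0
digitSqSumFuel (suc f) b zero = 0
digitSqSumFuel (suc f) b n@(suc _) = (n % b) * (n % b) + digitSqSumFuel f b (n / b)

digitSqSum : (b : ℕ) → .{{NonZero b}} → ℕ → ℕ
digitSqSum b n = digitSqSumFuel n b n

S : (c b : ℕ) → .{{NonZero b}} → ℕ → ℕ
S c b n = c + digitSqSum b n

IsFixedPoint : (c b : ℕ) → .{{NonZero b}} → ℕ → Set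
IsFixedPoint c b a = (1 ≤ a) × (S c b a ≡ a)

HasFixedPoint : (c b : ℕ) → .{{NonZero b}} → Set
HasFixedPoint c b = Σ ℕ (λ a → IsFixedPoint c b a)

-- The set {c, c+1, ..., c+k-1} is a k-oasis base b.
-- (A k-oasis is uniquely determined by its least element c.)
IsOasis : (k b : ℕ) → .{{NonZero b}} → ℕ → Set
IsOasis k b c = (i : ℕ) → i < k → HasFixedPoint (c + i) b

open import Data.Empty using (⊥)

-- Same as IsOasis, for a plain base b; only meaningful for b ≥ 2
-- (for b < 2 base-b expansions do not exist and we set it to ⊥;
-- the theorem assumes b ≥ 2 anyway).
IsOasisBase : (k b c : ℕ) → Set
IsOasisBase k zero c = ⊥
IsOasisBase k (suc zero) c = ⊥
IsOasisBase k b@(suc (suc _)) c = IsOasis k b c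

{-# OPTIONS --safe #-}
-- If a < b^m then a + b^m has one more digit 1 than a in base b, so its digit-square sum is
-- one larger. Hence a fixed point a of S_[c,b] with a < b^m yields the fixed point a + b^m of
-- S_[c + b^m - 1, b]. The fixed points witnessing a k-oasis {c, …, c+k-1} are finitely many,
-- so one m with b^m above all of them (and above any given N) shifts the whole oasis to
-- {c', …, c'+k-1} with c' = c + b^m - 1 ≥ N.
module Submission where

open import Defs
open import Data.Nat
open import Data.Nat.Properties
open import Data.Nat.DivMod
open import Data.Nat.Divisibility using (n∣m*n)
open import Data.Nat.Solver using (module +-*-Solver)
open import Data.Product using (Σ; _×_; _,_)
open import Data.Sum using (inj₁; inj₂)
open import Relation.Binary.PropositionalEquality
open import Algebra.Properties.CommutativeSemigroup +-commutativeSemigroup using (xy∙z≈xz∙y)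

boundWitnesses : (P : ℕ → ℕ → Set) (k : ℕ) → ((i : ℕ) → i < k → Σ ℕ (P i)) →
  Σ ℕ (λ M → (i : ℕ) → i < k → Σ ℕ (λ a → P i a × a < M))
boundWitnesses P zero wit = 0 , λ i ()
boundWitnesses P (suc k) wit
  with boundWitnesses P k (λ i i<k → wit i (m<n⇒m<1+n i<k)) | wit k ≤-refl
... | M , bounded | a , Pka = suc (M + a) , bounded′
  where
  bounded′ : (i : ℕ) → i < suc k → Σ ℕ (λ x → P i x × x < suc (M + a))
  bounded′ i i<1+k with m<1+n⇒m<n∨m≡n i<1+k
  ... | inj₁ i<k with bounded i i<k
  ...   | x , Pix , x<M = x , Pix , m<n⇒m<1+n (≤-trans x<M (m≤m+n M a))
  bounded′ i i<1+k | inj₂ refl = a , Pka , s≤s (m≤n+m a M)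

module _ (b : ℕ) {{_ : NonZero b}} (1<b : 1 < b) where

  n<b^n : ∀ n → n < b ^ n
  n<b^n zero    = s≤s z≤n
  n<b^n (suc n) = ≤-<-trans (n<b^n n)
    (subst (b ^ n <_) (*-comm (b ^ n) b) (m<m*n (b ^ n) b {{m^n≢0 b n}} 1<b))

  digitSqSumFuel-irrelevant : ∀ f g n → n ≤ f → n ≤ g →
    digitSqSumFuel f b n ≡ digitSqSumFuel g b n
  digitSqSumFuel-irrelevant zero    zero    zero _ _ = refl
  digitSqSumFuel-irrelevant zero    (suc g) zero _ _ = refl
  digitSqSumFuel-irrelevant (suc f) zero    zero _ _ = refl
  digitSqSumFuel-irrelevant (suc f) (suc g) zero _ _ = refl
  digitSqSumFuel-irrelevant (suc f) (suc g) n@(suc _) (s≤s n≤f) (s≤s n≤g) =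
    cong ((n % b) * (n % b) +_)
      (digitSqSumFuel-irrelevant f g (n / b) (≤-trans n/b≤n-1 n≤f) (≤-trans n/b≤n-1 n≤g))
    where
    n/b≤n-1 : n / b ≤ pred n
    n/b≤n-1 = ≤-pred (m/n<m n b 1<b)

  digitSqSum-step : ∀ n → digitSqSum b n ≡ (n % b) * (n % b) + digitSqSum b (n / b)
  digitSqSum-step zero        =
    sym (cong₂ (λ r q → r * r + digitSqSum b q) (m<n⇒m%n≡m (<⇒≤ 1<b)) (0/n≡0 b))
  digitSqSum-step n@(suc n-1) =
    cong ((n % b) * (n % b) +_)
      (digitSqSumFuel-irrelevant n-1 (n / b) (n / b) (≤-pred (m/n<m n b 1<b)) ≤-refl)

  digitSqSum-+-pow : ∀ m a → a < b ^ m → digitSqSum b (a + b ^ m) ≡ digitSqSum b a + 1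
  digitSqSum-+-pow zero    zero    _ =
    trans (digitSqSum-step 1)
      (cong₂ (λ r q → r * r + digitSqSum b q) (m<n⇒m%n≡m 1<b) (m<n⇒m/n≡0 1<b))
  digitSqSum-+-pow zero    (suc _) (s≤s ())
  digitSqSum-+-pow (suc m) a a<b^1+m = begin
      digitSqSum b (a + b ^ suc m)
    ≡⟨ cong (λ x → digitSqSum b (a + x)) (*-comm b (b ^ m)) ⟩
      digitSqSum b (a + b ^ m * b)
    ≡⟨ digitSqSum-step (a + b ^ m * b) ⟩
      ((a + b ^ m * b) % b) * ((a + b ^ m * b) % b) + digitSqSum b ((a + b ^ m * b) / b)
    ≡⟨ cong₂ (λ r q → r * r + digitSqSum b q) ([m+kn]%n≡m%n a (b ^ m) b) quotient ⟩
      (a % b) * (a % b) + digitSqSum b (a / b + b ^ m)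
    ≡⟨ cong ((a % b) * (a % b) +_) (digitSqSum-+-pow m (a / b) a/b<b^m) ⟩
      (a % b) * (a % b) + (digitSqSum b (a / b) + 1)
    ≡⟨ sym (+-assoc ((a % b) * (a % b)) _ 1) ⟩
      (a % b) * (a % b) + digitSqSum b (a / b) + 1
    ≡⟨ cong (_+ 1) (sym (digitSqSum-step a)) ⟩
      digitSqSum b a + 1 ∎
    where
    open ≡-Reasoning
    quotient : (a + b ^ m * b) / b ≡ a / b + b ^ m
    quotient = trans (+-distrib-/-∣ʳ a (n∣m*n (b ^ m))) (cong (a / b +_) (m*n/n≡m (b ^ m) b))
    a/b<b^m : a / b < b ^ m
    a/b<b^m = m<n*o⇒m/o<n (subst (a <_) (*-comm b (b ^ m)) a<b^1+m)

  isFixedPoint-+-pow : ∀ {c a} m → IsFixedPoint c b a → a < b ^ m →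
    IsFixedPoint (c + pred (b ^ m)) b (a + b ^ m)
  isFixedPoint-+-pow {c} {a} m (_ , Sa≡a) a<b^m = ≤-trans (m^n>0 b m) (m≤n+m (b ^ m) a) , (begin
      c + p + digitSqSum b (a + b ^ m)
    ≡⟨ cong (c + p +_) (digitSqSum-+-pow m a a<b^m) ⟩
      c + p + (digitSqSum b a + 1)
    ≡⟨ rearrange c p (digitSqSum b a) ⟩
      c + digitSqSum b a + suc p
    ≡⟨ cong₂ _+_ Sa≡a (suc-pred (b ^ m) {{m^n≢0 b m}}) ⟩
      a + b ^ m ∎)
    where
    open ≡-Reasoning
    open +-*-Solver
    p : ℕ
    p = pred (b ^ m)
    rearrange : ∀ c p d → c + p + (d + 1) ≡ c + d + suc p
    rearrange = solve 3 (λ c p d → c :+ p :+ (d :+ con 1) := c :+ d :+ (con 1 :+ p)) refl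

  isOasis-shift : ∀ {k c} m →
    ((i : ℕ) → i < k → Σ ℕ (λ a → IsFixedPoint (c + i) b a × a < b ^ m)) →
    IsOasis k b (c + pred (b ^ m))
  isOasis-shift {c = c} m small i i<k with small i i<k
  ... | a , fixed , a<b^m =
    a + b ^ m ,
    subst (λ c′ → IsFixedPoint c′ b (a + b ^ m)) (xy∙z≈xz∙y c i (pred (b ^ m)))
      (isFixedPoint-+-pow m fixed a<b^m)

  isOasis-unbounded : ∀ {k c} → IsOasis k b c → (N : ℕ) →
    Σ ℕ (λ c′ → (N ≤ c′) × IsOasis k b c′)
  isOasis-unbounded {k} {c} oasis N with boundWitnesses (λ i → IsFixedPoint (c + i) b) k oasis
  ... | M , bounded = c + pred (b ^ m) , N≤c′ , isOasis-shift m small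
    where
    m : ℕ
    m = M + N
    small : (i : ℕ) → i < k → Σ ℕ (λ a → IsFixedPoint (c + i) b a × a < b ^ m)
    small i i<k with bounded i i<k
    ... | a , fixed , a<M = a , fixed , ≤-trans a<M (≤-trans (m≤m+n M N) (<⇒≤ (n<b^n m)))
    N≤c′ : N ≤ c + pred (b ^ m)
    N≤c′ = ≤-trans (suc[m]≤n⇒m≤pred[n] (≤-trans (s≤s (m≤n+m N M)) (n<b^n m))) (m≤n+m _ c)

theorem4 : (b k : ℕ) → 2 ≤ b → 1 ≤ k →
    Σ ℕ (λ c → IsOasisBase k b c) →
    (N : ℕ) → Σ ℕ (λ c → (N ≤ c) × IsOasisBase k b c)
theorem4 b@(suc (suc _)) _ 2≤b _ (_ , oasis) = isOasis-unbounded b 2≤b oasis
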